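{- Let $n=\Omega(d^{1/2})$, $b\ge3\log n$ and $(r_1,r_2)\in\{0,1\}\times\{0,1\}$. For $x$ uniformly random in $\Sigma_b^{\mathbb{Z}_n^2}$, $\Pr[\textsc{Min-Hash}(x,d)-\textsc{Min-Hash}(x\ll(r_1,r_2),d)\neq(r_1,r_2)]=O(d^{ -1/2})$.
   Context: $\Sigma_b=\{0,1\}^b$, with symbols compared as $b$-bit integers. For $x\in\Sigma_b^{\mathbb{Z}_n^2}$, $(x\ll(r_1,r_2))[i,j]=x[i+r_1,j+r_2]$ (indices mod $n$). $\textsc{Min-Hash}(x,d)$ returns $\arg\min_{i,j\in\{0,1,\dots,\lfloor\sqrt d\rfloor\}}x[i,j]$, the index pair at which the minimum value is attained (ties broken by a fixed rule). -}

module Defs where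

open import Data.Nat using (ℕ; zero; suc; _+_; _*_; _^_; _≤ᵇ_; _<ᵇ_; _%_; NonZero)
open import Data.Nat.DivMod using (m%n<n)
open import Data.Fin using (Fin; toℕ; fromℕ<)
open import Data.Vec using (Vec; []; _∷_; lookup)
open import Data.List using (List; []; _∷_; [_]; map; concatMap; upTo; allFin; filter; length)
open import Data.Product using (_×_; _,_; proj₁; proj₂)
open import Data.Bool using (Bool; if_then_else_)
open import Data.Integer using (ℤ; +_; _-_)
open import Relation.Nullary using (¬_; ¬?)
open import Relation.Nullary.Decidable using (_×-dec_)
open import Relation.Unary using (Decidable)
import Data.Integer.Properties as ℤP

-- Alphabet Σ_b = {0,1}^b, identified with Fin (2 ^ b) (symbols compared as b-bit integers).
Sym : ℕ → Set
Sym b = Fin (2 ^ b)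

-- An element x ∈ Σ_b^{ℤ_n²}: an n × n grid of symbols (rows indexed by the first coordinate).
Grid : ℕ → ℕ → Set
Grid n b = Vec (Vec (Sym b) n) n

at : ∀ {n b} .{{_ : NonZero n}} → Grid n b → ℕ → ℕ → ℕ
at {n} {b} x i j = toℕ (lookup (lookup x (fromℕ< (m%n<n i n))) (fromℕ< (m%n<n j n)))

shift : (ℕ → ℕ → ℕ) → ℕ → ℕ → (ℕ → ℕ → ℕ)
shift f r₁ r₂ i j = f (i + r₁) (j + r₂)

isqrtFrom : ℕ → ℕ → ℕ
isqrtFrom d zero = zero
isqrtFrom d (suc k) = if (suc k * suc k) ≤ᵇ d then suc k else isqrtFrom d k

isqrt : ℕ → ℕ
isqrt d = isqrtFrom d d

window : ℕ → List (ℕ × ℕ)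
window k = concatMap (λ i → map (λ j → (i , j)) (upTo (suc k))) (upTo (suc k))

argminFrom : (ℕ → ℕ → ℕ) → ℕ × ℕ → List (ℕ × ℕ) → ℕ × ℕ
argminFrom f best [] = best
argminFrom f best (p ∷ ps) =
  argminFrom f (if f (proj₁ p) (proj₂ p) <ᵇ f (proj₁ best) (proj₂ best) then p else best) ps

-- Min-Hash(x,d) = argmin_{i,j ∈ {0,…,⌊√d⌋}} x[i,j], ties broken by the lexicographically
-- smallest index pair (i,j).
minHash : (ℕ → ℕ → ℕ) → ℕ → ℕ × ℕ
minHash f d = argminFrom f (0 , 0) (window (isqrt d))

allVecs : ∀ {A : Set} (k : ℕ) → List A → List (Vec A k)
allVecs zero xs = [ [] ]
allVecs (suc k) xs = concatMap (λ a → map (a ∷_) (allVecs k xs)) xs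

allGrids : (n b : ℕ) → List (Grid n b)
allGrids n b = allVecs n (allVecs n (allFin (2 ^ b)))

HashOK : ∀ {n b} .{{_ : NonZero n}} → ℕ → ℕ → ℕ → Grid n b → Set
HashOK {n} {b} d r₁ r₂ x =
  let f = at {n} {b} x
      h = minHash f d
      h' = minHash (shift f r₁ r₂) d
  in ((+ proj₁ h) - (+ proj₁ h') ≡ + r₁) × ((+ proj₂ h) - (+ proj₂ h') ≡ + r₂)
  where open import Relation.Binary.PropositionalEquality using (_≡_)

hashOK? : ∀ {n b} .{{_ : NonZero n}} (d r₁ r₂ : ℕ) → Decidable (HashOK {n} {b} d r₁ r₂)
hashOK? {n} {b} d r₁ r₂ x = (_ ℤP.≟ _) ×-dec (_ ℤP.≟ _)

-- Number of x ∈ Σ_b^{ℤ_n²} with Min-Hash(x,d) − Min-Hash(x ≪ (r₁,r₂), d) ≠ (r₁,r₂).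
-- Pr over uniform x equals failCount / (2^b)^(n*n).
failCount : (n b d r₁ r₂ : ℕ) .{{_ : NonZero n}} → ℕ
failCount n b d r₁ r₂ = length (filter (λ x → ¬? (hashOK? {n} {b} d r₁ r₂ x)) (allGrids n b))

-- Let s = min (⌊√d⌋ + 2, n). The window {0,…,⌊√d⌋}² and its unit shifts all lie, modulo n, in the
-- s × s box at the origin. If the minimum of x over this box sits at a single cell off the edge of the
-- box, Min-Hash finds that cell in x and finds it again, moved by (r₁ , r₂), in the shifted grid. So a
-- failure needs the box minimum on one of the at most 4s edge cells, or shared by one of the at most
-- s⁴ pairs of cells. As the cells of a random grid are independent, the probability that j given cells
-- all carry the box minimum is at most 2 / ((s² - j + 1) N^(j-1)), where N = 2^b. This is O(1/s) for
-- an edge cell and O(s² / N) = O(1/s) for a pair, because N ≥ n³ ≥ s³; and ⌊√d⌋ = O(s).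

module Submission where

open import Defs
open import Data.Nat using (ℕ; _*_; _^_; _≤_; NonZero)
open import Data.Fin using (Fin; toℕ)
open import Data.Product using (∃-syntax)

open import Data.Nat using (zero; suc; _+_; _∸_; _<_; _⊓_; _≤?_; z≤n; s≤s; _<ᵇ_; _≡ᵇ_; >-nonZero; >-nonZero⁻¹)
open import Data.Nat.Properties
open import Data.Nat.DivMod using (_%_; m%n<n; m<n⇒m%n≡m; m%n%n≡m%n; m%n≤m)
open import Data.Nat.Tactic.RingSolver using (solve-∀)
open import Algebra.Properties.CommutativeSemigroup *-commutativeSemigroup using (xy∙z≈y∙xz; xy∙z≈xz∙y)
import Data.Integer as ℤ
import Data.Integer.Properties as ℤ
import Data.Fin as Fin
import Data.Fin.Properties as Fin
open import Data.Vec using (Vec; lookup)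
open import Data.List using (List; []; _∷_; _++_; foldr; map; concatMap; upTo; allFin; tabulate; filter; length)
open import Data.List.Properties using (length-++; length-map; length-upTo; length-filter)
open import Data.List.Membership.Propositional using (_∈_; _∉_; find; lose)
open import Data.List.Membership.Propositional.Properties
  using (∈-map⁺; ∈-map⁻; ∈-concat⁺′; ∈-concat⁻′; ∈-upTo⁺; ∈-upTo⁻; ∈-filter⁺; ∈-filter⁻; ∈-++⁺ˡ; ∈-++⁺ʳ)
open import Data.List.Relation.Unary.Any using (Any; here; there; any?)
open import Data.List.Relation.Unary.All as All using (All; []; _∷_)
open import Data.List.Relation.Unary.All.Properties using (All¬⇒¬Any)
open import Data.List.Relation.Unary.AllPairs using (AllPairs)
import Data.List.Relation.Unary.AllPairs as AllPairs
import Data.List.Relation.Unary.AllPairs.Properties as AllPairs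
open import Data.List.Relation.Unary.Unique.Propositional using (Unique)
open import Data.List.Extrema.Nat using (argmin; argmin-sel; f[argmin]≤f[xs])
open import Data.Product using (_×_; _,_; proj₁; proj₂; uncurry)
open import Data.Product.Properties using (≡-dec)
open import Data.Sum using (_⊎_; inj₁; inj₂; [_,_]′)
open import Data.Bool using (true; false; if_then_else_)
import Data.Bool as Bool
open import Data.Empty using (⊥-elim)
open import Function using (_∘_; id)
open import Relation.Nullary using (¬_; ¬?; Dec; yes; no; does)
open import Relation.Nullary.Decidable using (_×-dec_)
open import Relation.Binary using (DecidableEquality)
open import Relation.Binary.PropositionalEquality

private
  variable
    A B : Set

sumBy : (A → ℕ) → List A → ℕ
sumBy f [] = 0
sumBy f (x ∷ xs) = f x + sumBy f xs

sumBy-++ : (f : A → ℕ) (xs ys : List A) → sumBy f (xs ++ ys) ≡ sumBy f xs + sumBy f ys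
sumBy-++ f [] ys = refl
sumBy-++ f (x ∷ xs) ys = trans (cong (f x +_) (sumBy-++ f xs ys)) (sym (+-assoc (f x) _ _))

sumBy-map : (f : B → ℕ) (g : A → B) (xs : List A) → sumBy f (map g xs) ≡ sumBy (f ∘ g) xs
sumBy-map f g [] = refl
sumBy-map f g (x ∷ xs) = cong (f (g x) +_) (sumBy-map f g xs)

sumBy-concatMap : (f : B → ℕ) (g : A → List B) (xs : List A) →
  sumBy f (concatMap g xs) ≡ sumBy (sumBy f ∘ g) xs
sumBy-concatMap f g [] = refl
sumBy-concatMap f g (x ∷ xs) =
  trans (sumBy-++ f (g x) (concatMap g xs)) (cong (sumBy f (g x) +_) (sumBy-concatMap f g xs))

sumBy-cong : {f g : A → ℕ} (xs : List A) → (∀ x → f x ≡ g x) → sumBy f xs ≡ sumBy g xs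
sumBy-cong [] f≗g = refl
sumBy-cong (x ∷ xs) f≗g = cong₂ _+_ (f≗g x) (sumBy-cong xs f≗g)

sumBy-∈ : (f : A → ℕ) {x : A} {xs : List A} → x ∈ xs → f x ≤ sumBy f xs
sumBy-∈ f {xs = y ∷ xs} (here refl) = m≤m+n (f y) _
sumBy-∈ f {xs = y ∷ xs} (there x∈xs) = ≤-trans (sumBy-∈ f x∈xs) (m≤n+m _ (f y))

sumBy-+ : (f g : A → ℕ) (xs : List A) → sumBy (λ x → f x + g x) xs ≡ sumBy f xs + sumBy g xs
sumBy-+ f g [] = refl
sumBy-+ f g (x ∷ xs) rewrite sumBy-+ f g xs = +-interchange (f x) (g x) _ _
  where
  +-interchange : ∀ a b c d → a + b + (c + d) ≡ a + c + (b + d)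
  +-interchange = solve-∀

sumBy-*ˡ : (c : ℕ) (f : A → ℕ) (xs : List A) → sumBy (λ x → c * f x) xs ≡ c * sumBy f xs
sumBy-*ˡ c f [] = sym (*-zeroʳ c)
sumBy-*ˡ c f (x ∷ xs) = trans (cong (c * f x +_) (sumBy-*ˡ c f xs)) (sym (*-distribˡ-+ c (f x) _))

sumBy-*ʳ : (c : ℕ) (f : A → ℕ) (xs : List A) → sumBy (λ x → f x * c) xs ≡ sumBy f xs * c
sumBy-*ʳ c f [] = refl
sumBy-*ʳ c f (x ∷ xs) = trans (cong (f x * c +_) (sumBy-*ʳ c f xs)) (sym (*-distribʳ-+ c (f x) _))

sumBy-zero : (xs : List A) → sumBy (λ _ → 0) xs ≡ 0
sumBy-zero [] = refl
sumBy-zero (x ∷ xs) = sumBy-zero xs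

sumBy-≤-length : (f : A → ℕ) (c : ℕ) (xs : List A) → (∀ {x} → x ∈ xs → f x ≤ c) → sumBy f xs ≤ length xs * c
sumBy-≤-length f c [] f≤c = z≤n
sumBy-≤-length f c (x ∷ xs) f≤c = +-mono-≤ (f≤c (here refl)) (sumBy-≤-length f c xs (f≤c ∘ there))

sumBy-comm : (F : A → B → ℕ) (xs : List A) (ys : List B) →
  sumBy (λ x → sumBy (F x) ys) xs ≡ sumBy (λ y → sumBy (λ x → F x y) xs) ys
sumBy-comm F [] ys = sym (sumBy-zero ys)
sumBy-comm F (x ∷ xs) ys =
  trans (cong (sumBy (F x) ys +_) (sumBy-comm F xs ys)) (sym (sumBy-+ (F x) _ ys))

length-filter-≤-sumBy : {P : A → Set} (P? : ∀ x → Dec (P x)) (f : A → ℕ) (xs : List A) →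
  (∀ x → P x → 1 ≤ f x) → length (filter P? xs) ≤ sumBy f xs
length-filter-≤-sumBy P? f [] Px⇒1≤fx = z≤n
length-filter-≤-sumBy P? f (x ∷ xs) Px⇒1≤fx with P? x
... | yes Px = +-mono-≤ (Px⇒1≤fx x Px) (length-filter-≤-sumBy P? f xs Px⇒1≤fx)
... | no _ = ≤-trans (length-filter-≤-sumBy P? f xs Px⇒1≤fx) (m≤n+m _ (f x))

sumBelow : ℕ → (ℕ → ℕ) → ℕ
sumBelow zero f = 0
sumBelow (suc n) f = f 0 + sumBelow n (f ∘ suc)

sumBelow-mono : (n : ℕ) {f g : ℕ → ℕ} → (∀ i → i < n → f i ≤ g i) → sumBelow n f ≤ sumBelow n g
sumBelow-mono zero f≤g = z≤n
sumBelow-mono (suc n) f≤g = +-mono-≤ (f≤g 0 (s≤s z≤n)) (sumBelow-mono n (λ i i<n → f≤g (suc i) (s≤s i<n)))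

sumBelow-∈ : (n : ℕ) (f : ℕ → ℕ) {i : ℕ} → i < n → f i ≤ sumBelow n f
sumBelow-∈ (suc n) f {zero} _ = m≤m+n (f 0) _
sumBelow-∈ (suc n) f {suc i} (s≤s i<n) = ≤-trans (sumBelow-∈ n (f ∘ suc) i<n) (m≤n+m _ (f 0))

sumBelow-*ʳ : (n c : ℕ) (f : ℕ → ℕ) → sumBelow n (λ i → f i * c) ≡ sumBelow n f * c
sumBelow-*ʳ zero c f = refl
sumBelow-*ʳ (suc n) c f =
  trans (cong (f 0 * c +_) (sumBelow-*ʳ n c (f ∘ suc))) (sym (*-distribʳ-+ c (f 0) _))

sumBelow-const : (n c : ℕ) → sumBelow n (λ _ → c) ≡ n * c
sumBelow-const zero c = refl
sumBelow-const (suc n) c = cong (c +_) (sumBelow-const n c)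

sumBy-sumBelow-comm : (n : ℕ) (F : A → ℕ → ℕ) (xs : List A) →
  sumBy (λ x → sumBelow n (F x)) xs ≡ sumBelow n (λ i → sumBy (λ x → F x i) xs)
sumBy-sumBelow-comm zero F xs = sumBy-zero xs
sumBy-sumBelow-comm (suc n) F xs =
  trans (sumBy-+ (λ x → F x 0) (λ x → sumBelow n (F x ∘ suc)) xs)
        (cong (sumBy (λ x → F x 0) xs +_) (sumBy-sumBelow-comm n (λ x → F x ∘ suc) xs))

prodBelow : ℕ → (ℕ → ℕ) → ℕ
prodBelow zero f = 1
prodBelow (suc n) f = f 0 * prodBelow n (f ∘ suc)

prodBelow-cong : (n : ℕ) {f g : ℕ → ℕ} → (∀ i → i < n → f i ≡ g i) → prodBelow n f ≡ prodBelow n g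
prodBelow-cong zero f≗g = refl
prodBelow-cong (suc n) f≗g = cong₂ _*_ (f≗g 0 (s≤s z≤n)) (prodBelow-cong n (λ i i<n → f≗g (suc i) (s≤s i<n)))

prodBelow-mono : (n : ℕ) {f g : ℕ → ℕ} → (∀ i → i < n → f i ≤ g i) → prodBelow n f ≤ prodBelow n g
prodBelow-mono zero f≤g = ≤-refl
prodBelow-mono (suc n) f≤g = *-mono-≤ (f≤g 0 (s≤s z≤n)) (prodBelow-mono n (λ i i<n → f≤g (suc i) (s≤s i<n)))

prodBelow-* : (n : ℕ) (f g : ℕ → ℕ) → prodBelow n (λ i → f i * g i) ≡ prodBelow n f * prodBelow n g
prodBelow-* zero f g = refl
prodBelow-* (suc n) f g rewrite prodBelow-* n (f ∘ suc) (g ∘ suc) = *-interchange (f 0) (g 0) _ _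
  where
  *-interchange : ∀ a b c d → a * b * (c * d) ≡ a * c * (b * d)
  *-interchange = solve-∀

prodBelow-const : (n c : ℕ) → prodBelow n (λ _ → c) ≡ c ^ n
prodBelow-const zero c = refl
prodBelow-const (suc n) c = cong (c *_) (prodBelow-const n c)

prodBelow-ones : (n : ℕ) (f : ℕ → ℕ) → (∀ i → i < n → f i ≡ 1) → prodBelow n f ≡ 1
prodBelow-ones n f f≗1 = trans (prodBelow-cong n f≗1) (trans (prodBelow-const n 1) (^-zeroˡ n))

prodBelow-single : (n j : ℕ) (f : ℕ → ℕ) → j < n → (∀ i → i < n → i ≢ j → f i ≡ 1) → prodBelow n f ≡ f j
prodBelow-single (suc n) zero f _ f≗1 =
  trans (cong (f 0 *_) (prodBelow-ones n (f ∘ suc) (λ i i<n → f≗1 (suc i) (s≤s i<n) λ ())))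
        (*-identityʳ (f 0))
prodBelow-single (suc n) (suc j) f (s≤s j<n) f≗1 =
  trans (cong₂ _*_ (f≗1 0 (s≤s z≤n) λ ())
                   (prodBelow-single n j (f ∘ suc) j<n
                                     (λ i i<n i≢j → f≗1 (suc i) (s≤s i<n) (i≢j ∘ suc-injective))))
        (*-identityˡ _)

prodBelow-prefix : (n s A : ℕ) (f : ℕ → ℕ) → s ≤ n →
  (∀ i → i < s → f i ≡ A) → (∀ i → s ≤ i → i < n → f i ≡ 1) → prodBelow n f ≡ A ^ s
prodBelow-prefix n zero A f _ _ f≗1 = prodBelow-ones n f (λ i → f≗1 i z≤n)
prodBelow-prefix (suc n) (suc s) A f (s≤s s≤n) f≗A f≗1 =
  cong₂ _*_ (f≗A 0 (s≤s z≤n))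
            (prodBelow-prefix n s A (f ∘ suc) s≤n (λ i i<s → f≗A (suc i) (s≤s i<s))
                              (λ i s≤i i<n → f≗1 (suc i) (s≤s s≤i) (s≤s i<n)))

prodFin : (k : ℕ) → (Fin k → ℕ) → ℕ
prodFin zero f = 1
prodFin (suc k) f = f Fin.zero * prodFin k (f ∘ Fin.suc)

prodFin-cong : (k : ℕ) {f g : Fin k → ℕ} → (∀ i → f i ≡ g i) → prodFin k f ≡ prodFin k g
prodFin-cong zero f≗g = refl
prodFin-cong (suc k) f≗g = cong₂ _*_ (f≗g Fin.zero) (prodFin-cong k (f≗g ∘ Fin.suc))

prodFin-toℕ : (k : ℕ) (f : ℕ → ℕ) → prodFin k (f ∘ toℕ) ≡ prodBelow k f
prodFin-toℕ zero f = refl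
prodFin-toℕ (suc k) f = cong (f 0 *_) (prodFin-toℕ k (f ∘ suc))

sumBy-tabulate : (k : ℕ) (g : Fin k → A) (f : A → ℕ) (h : ℕ → ℕ) →
  (∀ i → f (g i) ≡ h (toℕ i)) → sumBy f (tabulate g) ≡ sumBelow k h
sumBy-tabulate zero g f h fg≗h = refl
sumBy-tabulate (suc k) g f h fg≗h =
  cong₂ _+_ (fg≗h Fin.zero) (sumBy-tabulate k (g ∘ Fin.suc) f (h ∘ suc) (fg≗h ∘ Fin.suc))

Cell : Set
Cell = ℕ × ℕ

gridProd : ℕ → (Cell → ℕ) → ℕ
gridProd n G = prodBelow n (λ c → prodBelow n (λ e → G (c , e)))

Inside : ℕ → Cell → Set
Inside s q = proj₁ q < s × proj₂ q < s

inside? : (s : ℕ) (q : Cell) → Dec (Inside s q)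
inside? s q = proj₁ q <? s ×-dec proj₂ q <? s

_≟ᶜ_ : DecidableEquality Cell
_≟ᶜ_ = ≡-dec _≟_ _≟_

if-yes : {P X : Set} (P? : Dec P) {x y : X} → P → (if does P? then x else y) ≡ x
if-yes (yes _) _ = refl
if-yes (no ¬p) p = ⊥-elim (¬p p)

if-no : {P X : Set} (P? : Dec P) {x y : X} → ¬ P → (if does P? then x else y) ≡ y
if-no (yes p) ¬p = ⊥-elim (¬p p)
if-no (no _) _ = refl

gridProd-cong : (n : ℕ) {G H : Cell → ℕ} → (∀ q → Inside n q → G q ≡ H q) → gridProd n G ≡ gridProd n H
gridProd-cong n G≗H = prodBelow-cong n (λ c c<n → prodBelow-cong n (λ e e<n → G≗H (c , e) (c<n , e<n)))

gridProd-mono : (n : ℕ) {G H : Cell → ℕ} → (∀ q → Inside n q → G q ≤ H q) → gridProd n G ≤ gridProd n H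
gridProd-mono n G≤H = prodBelow-mono n (λ c c<n → prodBelow-mono n (λ e e<n → G≤H (c , e) (c<n , e<n)))

gridProd-* : (n : ℕ) (G H : Cell → ℕ) → gridProd n (λ q → G q * H q) ≡ gridProd n G * gridProd n H
gridProd-* n G H =
  trans (prodBelow-cong n (λ c _ → prodBelow-* n (λ e → G (c , e)) (λ e → H (c , e)))) (prodBelow-* n _ _)

gridProd-const : (n c : ℕ) → gridProd n (λ _ → c) ≡ c ^ (n * n)
gridProd-const n c =
  trans (prodBelow-cong n (λ _ _ → prodBelow-const n c)) (trans (prodBelow-const n (c ^ n)) (^-*-assoc c n n))

gridProd-pos : (n : ℕ) (G : Cell → ℕ) → (∀ q → Inside n q → 1 ≤ G q) → 1 ≤ gridProd n G
gridProd-pos n G 1≤G =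
  ≤-trans (≤-reflexive (sym (trans (gridProd-const n 1) (^-zeroˡ (n * n))))) (gridProd-mono n 1≤G)

gridProd-single : (n : ℕ) (p : Cell) (G : Cell → ℕ) → Inside n p →
  (∀ q → Inside n q → q ≢ p → G q ≡ 1) → gridProd n G ≡ G p
gridProd-single n (a , b) G (a<n , b<n) G≗1 =
  trans (prodBelow-single n a _ a<n otherRow≗1)
        (prodBelow-single n b _ b<n (λ e e<n e≢b → G≗1 _ (a<n , e<n) (e≢b ∘ cong proj₂)))
  where
  otherRow≗1 : ∀ c → c < n → c ≢ a → prodBelow n (λ e → G (c , e)) ≡ 1
  otherRow≗1 c c<n c≢a = prodBelow-ones n _ (λ e e<n → G≗1 _ (c<n , e<n) (c≢a ∘ cong proj₁))

gridProd-square : (n s A : ℕ) (G : Cell → ℕ) → s ≤ n → (∀ q → Inside s q → G q ≡ A) →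
  (∀ q → Inside n q → ¬ Inside s q → G q ≡ 1) → gridProd n G ≡ A ^ (s * s)
gridProd-square n s A G s≤n G≗A G≗1 =
  trans (prodBelow-prefix n s (A ^ s) _ s≤n innerRow outerRow) (^-*-assoc A s s)
  where
  innerRow : ∀ c → c < s → prodBelow n (λ e → G (c , e)) ≡ A ^ s
  innerRow c c<s = prodBelow-prefix n s A _ s≤n (λ e e<s → G≗A _ (c<s , e<s))
    (λ e s≤e e<n → G≗1 _ (<-≤-trans c<s s≤n , e<n) (λ inside → <⇒≱ (proj₂ inside) s≤e))
  outerRow : ∀ c → s ≤ c → c < n → prodBelow n (λ e → G (c , e)) ≡ 1
  outerRow c s≤c c<n = prodBelow-ones n _ (λ e e<n → G≗1 _ (c<n , e<n) (λ inside → <⇒≱ (proj₁ inside) s≤c))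

gridProd-update : (n : ℕ) (p : Cell) (G H : Cell → ℕ) → Inside n p →
  (∀ q → Inside n q → q ≢ p → G q ≡ H q) → gridProd n G * H p ≡ gridProd n H * G p
gridProd-update n p G H p∈n G≗H =
  begin
    gridProd n G * H p
  ≡⟨ cong (gridProd n G *_) (sym (trans (gridProd-single n p (δ (H p)) p∈n δ≗1) (δ-self (H p)))) ⟩
    gridProd n G * gridProd n (δ (H p))
  ≡⟨ sym (gridProd-* n G (δ (H p))) ⟩
    gridProd n (λ q → G q * δ (H p) q)
  ≡⟨ gridProd-cong n swap ⟩
    gridProd n (λ q → H q * δ (G p) q)
  ≡⟨ gridProd-* n H (δ (G p)) ⟩
    gridProd n H * gridProd n (δ (G p))
  ≡⟨ cong (gridProd n H *_) (trans (gridProd-single n p (δ (G p)) p∈n δ≗1) (δ-self (G p))) ⟩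
    gridProd n H * G p
  ∎
  where
  open ≡-Reasoning
  δ : ℕ → Cell → ℕ
  δ a q = if does (q ≟ᶜ p) then a else 1
  δ-self : ∀ a → δ a p ≡ a
  δ-self a = if-yes (p ≟ᶜ p) refl
  δ≗1 : ∀ {a} q → Inside n q → q ≢ p → δ a q ≡ 1
  δ≗1 q _ = if-no (q ≟ᶜ p)
  swap : ∀ q → Inside n q → G q * δ (H p) q ≡ H q * δ (G p) q
  swap q q∈n with q ≟ᶜ p
  ... | yes refl = *-comm (G p) (H p)
  ... | no q≢p = cong (_* 1) (G≗H q q∈n q≢p)

-- Cells of a uniformly random grid are independent

sumBy-allVecs-prodFin : {A : Set} (k : ℕ) (h : Fin k → A → ℕ) (xs : List A) →
  sumBy (λ v → prodFin k (λ i → h i (lookup v i))) (allVecs k xs) ≡ prodFin k (λ i → sumBy (h i) xs)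
sumBy-allVecs-prodFin zero h xs = refl
sumBy-allVecs-prodFin {A} (suc k) h xs =
  begin
    sumBy (λ v → prodFin (suc k) (λ i → h i (lookup v i))) (concatMap (λ a → map (a ∷_) (allVecs k xs)) xs)
  ≡⟨ sumBy-concatMap _ _ xs ⟩
    sumBy (λ a → sumBy (λ v → prodFin (suc k) (λ i → h i (lookup v i))) (map (a ∷_) (allVecs k xs))) xs
  ≡⟨ sumBy-cong xs (λ a → sumBy-map _ (a ∷_) (allVecs k xs)) ⟩
    sumBy (λ a → sumBy (λ v → h Fin.zero a * rest v) (allVecs k xs)) xs
  ≡⟨ sumBy-cong xs (λ a → sumBy-*ˡ (h Fin.zero a) rest (allVecs k xs)) ⟩
    sumBy (λ a → h Fin.zero a * sumBy rest (allVecs k xs)) xs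
  ≡⟨ sumBy-*ʳ (sumBy rest (allVecs k xs)) (h Fin.zero) xs ⟩
    sumBy (h Fin.zero) xs * sumBy rest (allVecs k xs)
  ≡⟨ cong (sumBy (h Fin.zero) xs *_) (sumBy-allVecs-prodFin k (h ∘ Fin.suc) xs) ⟩
    prodFin (suc k) (λ i → sumBy (h i) xs)
  ∎
  where
  open ≡-Reasoning
  open Data.Vec using (_∷_)
  rest : Vec A k → ℕ
  rest v = prodFin k (λ i → h (Fin.suc i) (lookup v i))

module _ {n b : ℕ} .{{_ : NonZero n}} where

  value : Grid n b → Cell → ℕ
  value x = uncurry (at {n} {b} x)

  value-lookup : (x : Grid n b) (c e : Fin n) → value x (toℕ c , toℕ e) ≡ toℕ (lookup (lookup x c) e)
  value-lookup x c e = cong₂ (λ c e → toℕ (lookup (lookup x c) e)) (fromℕ<-reduce c) (fromℕ<-reduce e)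
    where
    fromℕ<-reduce : (c : Fin n) → Fin.fromℕ< (m%n<n (toℕ c) n) ≡ c
    fromℕ<-reduce c = Fin.toℕ-injective (trans (Fin.toℕ-fromℕ< _) (m<n⇒m%n≡m (Fin.toℕ<n c)))

  sumBy-allGrids-gridProd : (w : Cell → ℕ → ℕ) →
    sumBy (λ x → gridProd n (λ q → w q (value x q))) (allGrids n b) ≡ gridProd n (λ q → sumBelow (2 ^ b) (w q))
  sumBy-allGrids-gridProd w =
    begin
      sumBy (λ x → gridProd n (λ q → w q (value x q))) (allGrids n b)
    ≡⟨ sumBy-cong (allGrids n b) (λ x → sym (gridProd-lookup x)) ⟩
      sumBy (λ x → prodFin n (λ c → prodFin n (λ e → w (toℕ c , toℕ e) (toℕ (lookup (lookup x c) e)))))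
            (allGrids n b)
    ≡⟨ sumBy-allVecs-prodFin n _ _ ⟩
      prodFin n (λ c → sumBy (λ row → prodFin n (λ e → w (toℕ c , toℕ e) (toℕ (lookup row e))))
                             (allVecs n (allFin (2 ^ b))))
    ≡⟨ prodFin-cong n (λ c → sumBy-allVecs-prodFin n _ _) ⟩
      prodFin n (λ c → prodFin n (λ e → sumBy (w (toℕ c , toℕ e) ∘ toℕ) (allFin (2 ^ b))))
    ≡⟨ prodFin-cong n (λ c → prodFin-cong n (λ e → sumBy-tabulate (2 ^ b) (λ u → u) _ _ (λ _ → refl))) ⟩
      prodFin n (λ c → prodFin n (λ e → sumBelow (2 ^ b) (w (toℕ c , toℕ e))))
    ≡⟨ prodFin-cong n (λ c → prodFin-toℕ n (λ e → sumBelow (2 ^ b) (w (toℕ c , e)))) ⟩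
      prodFin n (λ c → prodBelow n (λ e → sumBelow (2 ^ b) (w (toℕ c , e))))
    ≡⟨ prodFin-toℕ n (λ c → prodBelow n (λ e → sumBelow (2 ^ b) (w (c , e)))) ⟩
      gridProd n (λ q → sumBelow (2 ^ b) (w q))
    ∎
    where
    open ≡-Reasoning
    gridProd-lookup : (x : Grid n b) →
      prodFin n (λ c → prodFin n (λ e → w (toℕ c , toℕ e) (toℕ (lookup (lookup x c) e))))
        ≡ gridProd n (λ q → w q (value x q))
    gridProd-lookup x =
      trans (prodFin-cong n (λ c → prodFin-cong n (λ e → cong (w _) (sym (value-lookup x c e)))))
      (trans (prodFin-cong n (λ c → prodFin-toℕ n (λ e → w (toℕ c , e) (value x (toℕ c , e)))))
             (prodFin-toℕ n (λ c → prodBelow n (λ e → w (c , e) (value x (c , e))))))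

data Constraint : Set where
  equal atLeast free : Constraint

admits : Constraint → ℕ → ℕ → ℕ
admits equal v u = if u ≡ᵇ v then 1 else 0
admits atLeast v u = if u <ᵇ v then 0 else 1
admits free v u = 1

capacity : ℕ → Constraint → ℕ → ℕ
capacity N equal v = 1
capacity N atLeast v = N ∸ v
capacity N free v = N

sumBelow-admits : (N : ℕ) (c : Constraint) (v : ℕ) → sumBelow N (admits c v) ≤ capacity N c v
sumBelow-admits N equal v = atMostOne N v
  where
  atMostOne : ∀ N v → sumBelow N (admits equal v) ≤ 1
  atMostOne zero v = z≤n
  atMostOne (suc N) zero = ≤-reflexive (cong suc (trans (sumBelow-const N 0) (*-zeroʳ N)))
  atMostOne (suc N) (suc v) = atMostOne N v
sumBelow-admits N atLeast v = aboveThreshold N v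
  where
  aboveThreshold : ∀ N v → sumBelow N (admits atLeast v) ≤ N ∸ v
  aboveThreshold zero v = z≤n
  aboveThreshold (suc N) zero = ≤-reflexive (cong suc (trans (sumBelow-const N 1) (*-identityʳ N)))
  aboveThreshold (suc N) (suc v) = aboveThreshold N v
sumBelow-admits N free v = ≤-reflexive (trans (sumBelow-const N 1) (*-identityʳ N))

Pattern : Set
Pattern = Cell → Constraint

box : ℕ → Pattern
box s q = if does (inside? s q) then atLeast else free

pin : Cell → Pattern → Pattern
pin p π q = if does (q ≟ᶜ p) then equal else π q

pinned : ℕ → List Cell → Pattern
pinned s = foldr pin (box s)

box-inside : ∀ {s q} → Inside s q → box s q ≡ atLeast
box-inside {s} {q} = if-yes (inside? s q)

pin-self : (p : Cell) (π : Pattern) → pin p π p ≡ equal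
pin-self p π = if-yes (p ≟ᶜ p) refl

pin-other : ∀ {p q} (π : Pattern) → q ≢ p → pin p π q ≡ π q
pin-other {p} {q} π = if-no (q ≟ᶜ p)

pinned-∉ : (s : ℕ) {q : Cell} (P : List Cell) → q ∉ P → pinned s P q ≡ box s q
pinned-∉ s [] q∉P = refl
pinned-∉ s (p ∷ P) q∉P =
  trans (pin-other (pinned s P) (q∉P ∘ here)) (pinned-∉ s P (q∉P ∘ there))

atLeast-admits : ∀ {v u} → v ≤ u → 1 ≤ admits atLeast v u
atLeast-admits {v} {u} v≤u with u <ᵇ v in test
... | true = ⊥-elim (<⇒≱ (<ᵇ⇒< u v (subst Bool.T (sym test) _)) v≤u)
... | false = ≤-refl

equal-admits : ∀ {v u} → u ≡ v → 1 ≤ admits equal v u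
equal-admits {v} {u} refl with u ≡ᵇ u in test
... | true = ≤-refl
... | false = ⊥-elim (subst Bool.T test (≡⇒≡ᵇ u u refl))

admits-pinned : (s v : ℕ) (w : Cell → ℕ) (P : List Cell) → All (λ p → w p ≡ v) P →
  (∀ q → Inside s q → v ≤ w q) → ∀ q → 1 ≤ admits (pinned s P q) v (w q)
admits-pinned s v w [] _ v≤w q with inside? s q
... | yes q∈s = subst (λ c → 1 ≤ admits c v (w q)) (sym (box-inside q∈s)) (atLeast-admits (v≤w q q∈s))
... | no q∉s = ≤-reflexive (cong (λ c → admits c v (w q)) (sym (if-no (inside? s q) q∉s)))
admits-pinned s v w (p ∷ P) (wp≡v ∷ onP) v≤w q with q ≟ᶜ p
... | yes refl = equal-admits wp≡v
... | no _ = admits-pinned s v w P onP v≤w q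

module _ (n N v : ℕ) where

  capacities : Pattern → ℕ
  capacities π = gridProd n (λ q → capacity N (π q) v)

  capacities-box : (s : ℕ) → s ≤ n → capacities (box s) * N ^ (s * s) ≡ (N ∸ v) ^ (s * s) * N ^ (n * n)
  capacities-box s s≤n =
    begin
      capacities (box s) * N ^ (s * s)
    ≡⟨ cong (capacities (box s) *_) (sym (onSquare-prod N)) ⟩
      capacities (box s) * gridProd n (onSquare N)
    ≡⟨ sym (gridProd-* n _ (onSquare N)) ⟩
      gridProd n (λ q → capacity N (box s q) v * onSquare N q)
    ≡⟨ gridProd-cong n (λ q _ → pointwise q) ⟩
      gridProd n (λ q → onSquare (N ∸ v) q * N)
    ≡⟨ gridProd-* n (onSquare (N ∸ v)) (λ _ → N) ⟩
      gridProd n (onSquare (N ∸ v)) * gridProd n (λ _ → N)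
    ≡⟨ cong₂ _*_ (onSquare-prod (N ∸ v)) (gridProd-const n N) ⟩
      (N ∸ v) ^ (s * s) * N ^ (n * n)
    ∎
    where
    open ≡-Reasoning
    onSquare : ℕ → Cell → ℕ
    onSquare a q = if does (inside? s q) then a else 1
    onSquare-prod : ∀ a → gridProd n (onSquare a) ≡ a ^ (s * s)
    onSquare-prod a = gridProd-square n s a (onSquare a) s≤n inSquare outSquare
      where
      inSquare : ∀ q → Inside s q → onSquare a q ≡ a
      inSquare q = if-yes (inside? s q)
      outSquare : ∀ q → Inside n q → ¬ Inside s q → onSquare a q ≡ 1
      outSquare q _ = if-no (inside? s q)
    pointwise : ∀ q → capacity N (box s q) v * onSquare N q ≡ onSquare (N ∸ v) q * N
    pointwise q with does (inside? s q)
    ... | true = refl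
    ... | false = trans (*-identityʳ N) (sym (*-identityˡ N))

  capacities-pin : (p : Cell) (π : Pattern) → Inside n p → π p ≡ atLeast →
    (N ∸ v) * capacities (pin p π) ≡ capacities π
  capacities-pin p π p∈n πp≡atLeast =
    begin
      (N ∸ v) * capacities (pin p π)
    ≡⟨ *-comm (N ∸ v) _ ⟩
      capacities (pin p π) * (N ∸ v)
    ≡⟨ cong (λ c → capacities (pin p π) * capacity N c v) (sym πp≡atLeast) ⟩
      capacities (pin p π) * capacity N (π p) v
    ≡⟨ gridProd-update n p _ _ p∈n (λ q _ q≢p → cong (λ c → capacity N c v) (pin-other π q≢p)) ⟩
      capacities π * capacity N (pin p π p) v
    ≡⟨ cong (λ c → capacities π * capacity N c v) (pin-self p π) ⟩
      capacities π * 1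
    ≡⟨ *-identityʳ _ ⟩
      capacities π
    ∎
    where open ≡-Reasoning

  capacities-pinned : (s : ℕ) (P : List Cell) → s ≤ n → Unique P → All (Inside s) P →
    (N ∸ v) ^ length P * capacities (pinned s P) ≡ capacities (box s)
  capacities-pinned s [] s≤n _ _ = *-identityˡ _
  capacities-pinned s (p ∷ P) s≤n (p∉P AllPairs.∷ uniqueP) (p∈s ∷ P⊆s) =
    begin
      (N ∸ v) * (N ∸ v) ^ length P * capacities (pin p (pinned s P))
    ≡⟨ xy∙z≈y∙xz (N ∸ v) _ _ ⟩
      (N ∸ v) ^ length P * ((N ∸ v) * capacities (pin p (pinned s P)))
    ≡⟨ cong ((N ∸ v) ^ length P *_) (capacities-pin p (pinned s P) p∈n pinned-p) ⟩
      (N ∸ v) ^ length P * capacities (pinned s P)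
    ≡⟨ capacities-pinned s P s≤n uniqueP P⊆s ⟩
      capacities (box s)
    ∎
    where
    open ≡-Reasoning
    p∈n : Inside n p
    p∈n = <-≤-trans (proj₁ p∈s) s≤n , <-≤-trans (proj₂ p∈s) s≤n
    pinned-p : pinned s P p ≡ atLeast
    pinned-p = trans (pinned-∉ s P (All¬⇒¬Any p∉P)) (box-inside p∈s)

bernoulli : (e M : ℕ) → M ^ suc e + suc e * M ^ e ≤ suc M ^ suc e
bernoulli zero M = ≤-reflexive (base M)
  where
  base : ∀ M → M * 1 + 1 * 1 ≡ (1 + M) * 1
  base = solve-∀
bernoulli (suc e) M =
  begin
    M ^ suc (suc e) + suc (suc e) * M ^ suc e
  ≤⟨ m≤m+n _ (suc e * M ^ e) ⟩
    M ^ suc (suc e) + suc (suc e) * M ^ suc e + suc e * M ^ e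
  ≡⟨ expand M (M ^ e) e ⟩
    suc M * (M ^ suc e + suc e * M ^ e)
  ≤⟨ *-monoʳ-≤ (suc M) (bernoulli e M) ⟩
    suc M ^ suc (suc e)
  ∎
  where
  open ≤-Reasoning
  expand : ∀ M X e → M * (M * X) + (2 + e) * (M * X) + (1 + e) * X ≡ (1 + M) * (M * X + (1 + e) * X)
  expand = solve-∀

powerSum : ℕ → ℕ → ℕ
powerSum e N = sumBelow N (λ v → (N ∸ v) ^ e)

powerSum-bound : (e N : ℕ) → suc e * powerSum e N ≤ N ^ suc e + suc e * N ^ e
powerSum-bound e zero = ≤-trans (≤-reflexive (*-zeroʳ (suc e))) z≤n
powerSum-bound e (suc N) =
  begin
    suc e * (suc N ^ e + powerSum e N)
  ≡⟨ *-distribˡ-+ (suc e) (suc N ^ e) (powerSum e N) ⟩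
    suc e * suc N ^ e + suc e * powerSum e N
  ≤⟨ +-monoʳ-≤ (suc e * suc N ^ e) (powerSum-bound e N) ⟩
    suc e * suc N ^ e + (N ^ suc e + suc e * N ^ e)
  ≤⟨ +-monoʳ-≤ (suc e * suc N ^ e) (bernoulli e N) ⟩
    suc e * suc N ^ e + suc N ^ suc e
  ≡⟨ +-comm (suc e * suc N ^ e) (suc N ^ suc e) ⟩
    suc N ^ suc e + suc e * suc N ^ e
  ∎
  where open ≤-Reasoning

powerSum-≤ : (e N : ℕ) → suc e ≤ N → suc e * powerSum e N ≤ 2 * N ^ suc e
powerSum-≤ e N e<N =
  begin
    suc e * powerSum e N
  ≤⟨ powerSum-bound e N ⟩
    N ^ suc e + suc e * N ^ e
  ≤⟨ +-monoʳ-≤ (N ^ suc e) (*-monoˡ-≤ (N ^ e) e<N) ⟩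
    N ^ suc e + N ^ suc e
  ≡⟨ cong (N ^ suc e +_) (sym (+-identityʳ (N ^ suc e))) ⟩
    2 * N ^ suc e
  ∎
  where open ≤-Reasoning

module Counting (n b : ℕ) .{{_ : NonZero n}} where

  N T : ℕ
  N = 2 ^ b
  T = N ^ (n * n)

  instance
    N≢0 : NonZero N
    N≢0 = m^n≢0 2 b

  matches : Pattern → ℕ → Grid n b → ℕ
  matches π v x = gridProd n (λ q → admits (π q) v (value {n} {b} x q))

  count : Pattern → ℕ → ℕ
  count π v = sumBy (matches π v) (allGrids n b)

  -- minCount s P counts the grids in which all cells of P carry the minimum of the s × s box.
  minCount : ℕ → List Cell → ℕ
  minCount s P = sumBelow N (count (pinned s P))

  count-≤-capacities : (π : Pattern) (v : ℕ) → count π v ≤ capacities n N v π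
  count-≤-capacities π v =
    ≤-trans (≤-reflexive (sumBy-allGrids-gridProd {n} {b} (λ q → admits (π q) v)))
            (gridProd-mono n (λ q _ → sumBelow-admits N (π q) v))

  count-pinned : (s v : ℕ) (P : List Cell) → s ≤ n → Unique P → All (Inside s) P →
    (N ∸ v) ^ length P * (count (pinned s P) v * N ^ (s * s)) ≤ (N ∸ v) ^ (s * s) * T
  count-pinned s v P s≤n uniqueP P⊆s =
    begin
      (N ∸ v) ^ length P * (count (pinned s P) v * N ^ (s * s))
    ≤⟨ *-monoʳ-≤ ((N ∸ v) ^ length P) (*-monoˡ-≤ (N ^ (s * s)) (count-≤-capacities (pinned s P) v)) ⟩
      (N ∸ v) ^ length P * (capacities n N v (pinned s P) * N ^ (s * s))
    ≡⟨ sym (*-assoc ((N ∸ v) ^ length P) _ _) ⟩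
      (N ∸ v) ^ length P * capacities n N v (pinned s P) * N ^ (s * s)
    ≡⟨ cong (_* N ^ (s * s)) (capacities-pinned n N v s P s≤n uniqueP P⊆s) ⟩
      capacities n N v (box s) * N ^ (s * s)
    ≡⟨ capacities-box n N v s s≤n ⟩
      (N ∸ v) ^ (s * s) * T
    ∎
    where open ≤-Reasoning

  count-pinned-≤ : (s v e : ℕ) (P : List Cell) → s ≤ n → Unique P → All (Inside s) P →
    length P + e ≡ s * s → v < N → count (pinned s P) v * N ^ (s * s) ≤ (N ∸ v) ^ e * T
  count-pinned-≤ s v e P s≤n uniqueP P⊆s |P|+e≡m v<N =
    *-cancelˡ-≤ ((N ∸ v) ^ length P) {{m^n≢0 (N ∸ v) (length P) {{>-nonZero (m<n⇒0<n∸m v<N)}}}}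
      (begin
        (N ∸ v) ^ length P * (count (pinned s P) v * N ^ (s * s))
      ≤⟨ count-pinned s v P s≤n uniqueP P⊆s ⟩
        (N ∸ v) ^ (s * s) * T
      ≡⟨ cong (λ k → (N ∸ v) ^ k * T) (sym |P|+e≡m) ⟩
        (N ∸ v) ^ (length P + e) * T
      ≡⟨ cong (_* T) (^-distribˡ-+-* (N ∸ v) (length P) e) ⟩
        (N ∸ v) ^ length P * (N ∸ v) ^ e * T
      ≡⟨ *-assoc ((N ∸ v) ^ length P) _ T ⟩
        (N ∸ v) ^ length P * ((N ∸ v) ^ e * T)
      ∎)
    where open ≤-Reasoning

  minCount-≤ : (s e : ℕ) (P : List Cell) → s ≤ n → Unique P → All (Inside s) P →
    length P + e ≡ s * s → minCount s P * N ^ (s * s) ≤ powerSum e N * T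
  minCount-≤ s e P s≤n uniqueP P⊆s |P|+e≡m =
    begin
      minCount s P * N ^ (s * s)
    ≡⟨ sym (sumBelow-*ʳ N (N ^ (s * s)) (count (pinned s P))) ⟩
      sumBelow N (λ v → count (pinned s P) v * N ^ (s * s))
    ≤⟨ sumBelow-mono N (λ v → count-pinned-≤ s v e P s≤n uniqueP P⊆s |P|+e≡m) ⟩
      sumBelow N (λ v → (N ∸ v) ^ e * T)
    ≡⟨ sumBelow-*ʳ N T (λ v → (N ∸ v) ^ e) ⟩
      powerSum e N * T
    ∎
    where open ≤-Reasoning

  probability-pinned : (s i e : ℕ) (P : List Cell) → s ≤ n → Unique P → All (Inside s) P →
    length P ≡ suc i → suc i + e ≡ s * s → suc e ≤ N → suc e * minCount s P * N ^ i ≤ 2 * T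
  probability-pinned s i e P s≤n uniqueP P⊆s |P|≡1+i 1+i+e≡m e<N =
    *-cancelʳ-≤ _ _ (N ^ suc e) {{m^n≢0 N (suc e)}}
      (begin
        suc e * minCount s P * N ^ i * N ^ suc e
      ≡⟨ regroup (suc e) (minCount s P) (N ^ i) (N ^ suc e) ⟩
        suc e * (minCount s P * (N ^ i * N ^ suc e))
      ≡⟨ cong (λ k → suc e * (minCount s P * k)) N^m-split ⟩
        suc e * (minCount s P * N ^ (s * s))
      ≤⟨ *-monoʳ-≤ (suc e) (minCount-≤ s e P s≤n uniqueP P⊆s (trans (cong (_+ e) |P|≡1+i) 1+i+e≡m)) ⟩
        suc e * (powerSum e N * T)
      ≡⟨ sym (*-assoc (suc e) (powerSum e N) T) ⟩
        suc e * powerSum e N * T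
      ≤⟨ *-monoˡ-≤ T (powerSum-≤ e N e<N) ⟩
        2 * N ^ suc e * T
      ≡⟨ xy∙z≈xz∙y 2 (N ^ suc e) T ⟩
        2 * T * N ^ suc e
      ∎)
    where
    open ≤-Reasoning
    regroup : ∀ a b c d → a * b * c * d ≡ a * (b * (c * d))
    regroup = solve-∀
    N^m-split : N ^ i * N ^ suc e ≡ N ^ (s * s)
    N^m-split = trans (sym (^-distribˡ-+-* N i (suc e))) (cong (N ^_) (trans (+-suc i e) 1+i+e≡m))

-- Min-Hash returns the lexicographically first minimum of its window

_≺_ : Cell → Cell → Set
p ≺ q = proj₁ p < proj₁ q ⊎ (proj₁ p ≡ proj₁ q × proj₂ p < proj₂ q)

windowRow : ℕ → ℕ → List Cell
windowRow k i = map (i ,_) (upTo (suc k))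

∈-window⁺ : ∀ {k i j} → i ≤ k → j ≤ k → (i , j) ∈ window k
∈-window⁺ {k} {i} i≤k j≤k =
  ∈-concat⁺′ (∈-map⁺ (i ,_) (∈-upTo⁺ (s≤s j≤k))) (∈-map⁺ (windowRow k) (∈-upTo⁺ (s≤s i≤k)))

∈-windowRow⁻ : ∀ {k i q} → q ∈ windowRow k i → proj₁ q ≡ i × proj₂ q ≤ k
∈-windowRow⁻ {k} {i} q∈row with ∈-map⁻ (i ,_) q∈row
... | j , j∈ , refl = refl , ≤-pred (∈-upTo⁻ j∈)

∈-window⁻ : ∀ {k q} → q ∈ window k → proj₁ q ≤ k × proj₂ q ≤ k
∈-window⁻ {k} q∈window with ∈-concat⁻′ (map (windowRow k) (upTo (suc k))) q∈window
... | row , q∈row , row∈rows with ∈-map⁻ (windowRow k) row∈rows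
... | i , i∈ , refl with ∈-windowRow⁻ {k} q∈row
... | refl , j≤k = ≤-pred (∈-upTo⁻ i∈) , j≤k

window-sorted : ∀ k → AllPairs _≺_ (window k)
window-sorted k =
  AllPairs.concat⁺ (All.tabulate rowSorted) (AllPairs.map⁺ (AllPairs.applyUpTo⁺₁ _ (suc k) rowsOrdered))
  where
  rowSorted : ∀ {row} → row ∈ map (windowRow k) (upTo (suc k)) → AllPairs _≺_ row
  rowSorted row∈ with ∈-map⁻ (windowRow k) row∈
  ... | i , _ , refl = AllPairs.map⁺ (AllPairs.applyUpTo⁺₁ _ (suc k) (λ j<j′ _ → inj₂ (refl , j<j′)))
  rowsOrdered : ∀ {i i′} → i < i′ → i′ < suc k → All (λ p → All (p ≺_) (windowRow k i′)) (windowRow k i)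
  rowsOrdered {i} {i′} i<i′ _ =
    All.tabulate (λ p∈ → All.tabulate (λ q∈ → earlierRow (∈-windowRow⁻ {k} p∈) (∈-windowRow⁻ {k} q∈)))
    where
    earlierRow : ∀ {p q} → proj₁ p ≡ i × proj₂ p ≤ k → proj₁ q ≡ i′ × proj₂ q ≤ k → p ≺ q
    earlierRow (refl , _) (refl , _) = inj₁ i<i′

WinsFrom : (ℕ → ℕ → ℕ) → Cell → Cell → List Cell → Set
WinsFrom f t best L = best ≡ t ⊎ (t ∈ L × uncurry f t < uncurry f best)

argminFrom-≡ : (f : ℕ → ℕ → ℕ) (t best : Cell) (L : List Cell) → AllPairs _≺_ L →
  (∀ {q} → q ∈ L → uncurry f t ≤ uncurry f q) → (∀ {q} → q ∈ L → q ≺ t → uncurry f t < uncurry f q) →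
  WinsFrom f t best L → argminFrom f best L ≡ t
argminFrom-≡ f t best [] _ _ _ (inj₁ best≡t) = best≡t
argminFrom-≡ f t best (q ∷ L) (q≺L AllPairs.∷ sorted) minimal strict invariant =
  argminFrom-≡ f t _ L sorted (minimal ∘ there) (strict ∘ there) (step invariant)
  where
  step : WinsFrom f t best (q ∷ L) → WinsFrom f t (if uncurry f q <ᵇ uncurry f best then q else best) L
  step wins with uncurry f q <ᵇ uncurry f best in test | wins
  ... | true | inj₁ refl = ⊥-elim (<⇒≱ (<ᵇ⇒< _ _ (subst Bool.T (sym test) _)) (minimal (here refl)))
  ... | true | inj₂ (here refl , _) = inj₁ refl
  ... | true | inj₂ (there t∈L , _) = inj₂ (t∈L , strict (here refl) (All.lookup q≺L t∈L))
  ... | false | inj₁ best≡t = inj₁ best≡t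
  ... | false | inj₂ (here refl , t<best) = ⊥-elim (subst Bool.T test (<⇒<ᵇ t<best))
  ... | false | inj₂ (there t∈L , t<best) = inj₂ (t∈L , t<best)

minHash-≡ : (f : ℕ → ℕ → ℕ) (d : ℕ) (t : Cell) → proj₁ t ≤ isqrt d → proj₂ t ≤ isqrt d →
  (∀ i j → i ≤ isqrt d → j ≤ isqrt d → uncurry f t ≤ f i j) →
  (∀ i j → i ≤ isqrt d → j ≤ isqrt d → (i , j) ≺ t → uncurry f t < f i j) →
  minHash f d ≡ t
minHash-≡ f d (a , b) a≤k b≤k minimal strict =
  argminFrom-≡ f (a , b) (0 , 0) (window k) (window-sorted k)
    (λ q∈ → minimal _ _ (proj₁ (∈-window⁻ q∈)) (proj₂ (∈-window⁻ q∈)))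
    (λ q∈ → strict _ _ (proj₁ (∈-window⁻ q∈)) (proj₂ (∈-window⁻ q∈)))
    (fromOrigin a b a≤k b≤k strict)
  where
  k : ℕ
  k = isqrt d
  fromOrigin : ∀ a b → a ≤ k → b ≤ k →
    (∀ i j → i ≤ k → j ≤ k → (i , j) ≺ (a , b) → f a b < f i j) → WinsFrom f (a , b) (0 , 0) (window k)
  fromOrigin zero zero _ _ _ = inj₁ refl
  fromOrigin zero (suc b) a≤k b≤k strict =
    inj₂ (∈-window⁺ a≤k b≤k , strict 0 0 z≤n z≤n (inj₂ (refl , s≤s z≤n)))
  fromOrigin (suc a) b a≤k b≤k strict =
    inj₂ (∈-window⁺ a≤k b≤k , strict 0 0 z≤n z≤n (inj₁ (s≤s z≤n)))

-- A strict minimum inside the box survives a unit shift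

Inner : ℕ → ℕ → Set
Inner s a = 0 < a × suc a < s

Interior : ℕ → Cell → Set
Interior s t = Inner s (proj₁ t) × Inner s (proj₂ t)

side : ℕ → ℕ → ℕ
side n d = suc (suc (isqrt d)) ⊓ n

ℤ-minus-∸ : ∀ a r → r ≤ a → ℤ.+ a ℤ.- ℤ.+ (a ∸ r) ≡ ℤ.+ r
ℤ-minus-∸ a r r≤a = trans (ℤ.m-n≡m⊖n a (a ∸ r)) (trans (ℤ.⊖-≥ (m∸n≤m a r)) (cong ℤ.+_ (m∸[m∸n]≡n r≤a)))

module StrictInteriorMinimum {n b : ℕ} .{{_ : NonZero n}} (x : Grid n b) (d : ℕ) (a a′ : ℕ)
  (interior : Interior (side n d) (a , a′))
  (strict : ∀ q → Inside (side n d) q → q ≢ (a , a′) → value {n} {b} x (a , a′) < value {n} {b} x q) where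

  private
    g : ℕ → ℕ → ℕ
    g = at {n} {b} x
    k s : ℕ
    k = isqrt d
    s = side n d

  g-reduce : ∀ i j → g i j ≡ value {n} {b} x (i % n , j % n)
  g-reduce i j = cong₂ (λ c e → toℕ (lookup (lookup x c) e)) (fromℕ<-reduce i) (fromℕ<-reduce j)
    where
    fromℕ<-reduce : ∀ i → Fin.fromℕ< (m%n<n i n) ≡ Fin.fromℕ< (m%n<n (i % n) n)
    fromℕ<-reduce i = Fin.toℕ-injective
      (trans (Fin.toℕ-fromℕ< _) (trans (sym (m%n%n≡m%n i n)) (sym (Fin.toℕ-fromℕ< _))))

  residue-in-box : ∀ i → i ≤ suc k → i % n < s
  residue-in-box i i≤1+k = ⊓-glb (s≤s (≤-trans (m%n≤m i n) i≤1+k)) (m%n<n i n)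

  inner-bounds : ∀ {c} → Inner s c → c < n × c ≤ k
  inner-bounds (_ , 1+c<s) =
    <-≤-trans (<-trans (n<1+n _) 1+c<s) (m⊓n≤n _ n) , ≤-pred (≤-pred (≤-trans 1+c<s (m⊓n≤m _ n)))

  strict-at : ∀ i j → i ≤ suc k → j ≤ suc k → (i % n , j % n) ≢ (a , a′) → g a a′ < g i j
  strict-at i j i≤ j≤ ≢t =
    subst (g a a′ <_) (sym (g-reduce i j)) (strict _ (residue-in-box i i≤ , residue-in-box j j≤) ≢t)

  minimal-at : ∀ i j → i ≤ suc k → j ≤ suc k → g a a′ ≤ g i j
  minimal-at i j i≤ j≤ with (i % n , j % n) ≟ᶜ (a , a′)
  ... | yes ≡t = ≤-reflexive (sym (trans (g-reduce i j) (cong (value {n} {b} x) ≡t)))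
  ... | no ≢t = <⇒≤ (strict-at i j i≤ j≤ ≢t)

  -- Window cells before the expected position stay below n after the shift, so they cannot wrap
  -- around onto (a , a′).
  shifted-min : (F : ℕ → ℕ → ℕ) (r₁ r₂ : ℕ) → r₁ ≤ 1 → r₂ ≤ 1 → (∀ i j → F i j ≡ g (i + r₁) (j + r₂)) →
    minHash F d ≡ (a ∸ r₁ , a′ ∸ r₂)
  shifted-min F r₁ r₂ r₁≤1 r₂≤1 F≗ =
    minHash-≡ F d _ (≤-trans (m∸n≤m a r₁) a≤k) (≤-trans (m∸n≤m a′ r₂) a′≤k)
      (λ i j i≤k j≤k → subst₂ _≤_ (sym F-at-min) (sym (F≗ i j))
                         (minimal-at _ _ (shift≤ i≤k r₁≤1) (shift≤ j≤k r₂≤1)))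
      (λ i j i≤k j≤k ≺t → subst₂ _<_ (sym F-at-min) (sym (F≗ i j))
                            (strict-at _ _ (shift≤ i≤k r₁≤1) (shift≤ j≤k r₂≤1) (moved ≺t)))
    where
    1≤a : 1 ≤ a
    1≤a = proj₁ (proj₁ interior)
    1≤a′ : 1 ≤ a′
    1≤a′ = proj₁ (proj₂ interior)
    a<n : a < n
    a<n = proj₁ (inner-bounds (proj₁ interior))
    a′<n : a′ < n
    a′<n = proj₁ (inner-bounds (proj₂ interior))
    a≤k : a ≤ k
    a≤k = proj₂ (inner-bounds (proj₁ interior))
    a′≤k : a′ ≤ k
    a′≤k = proj₂ (inner-bounds (proj₂ interior))
    F-at-min : F (a ∸ r₁) (a′ ∸ r₂) ≡ g a a′
    F-at-min = trans (F≗ _ _) (cong₂ g (m∸n+n≡m (≤-trans r₁≤1 1≤a)) (m∸n+n≡m (≤-trans r₂≤1 1≤a′)))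
    shift≤ : ∀ {i r} → i ≤ k → r ≤ 1 → i + r ≤ suc k
    shift≤ i≤k r≤1 = ≤-trans (+-mono-≤ i≤k r≤1) (≤-reflexive (+-comm k 1))
    residue-≢ : ∀ {i r c} → r ≤ c → c < n → i < c ∸ r → (i + r) % n ≢ c
    residue-≢ {i} {r} r≤c c<n i<c∸r =
      let i+r<c = subst (i + r <_) (m∸n+n≡m r≤c) (+-monoˡ-< r i<c∸r)
      in <⇒≢ i+r<c ∘ trans (sym (m<n⇒m%n≡m (<-trans i+r<c c<n)))
    moved : ∀ {i j} → (i , j) ≺ (a ∸ r₁ , a′ ∸ r₂) → ((i + r₁) % n , (j + r₂) % n) ≢ (a , a′)
    moved (inj₁ i<) = residue-≢ (≤-trans r₁≤1 1≤a) a<n i< ∘ cong proj₁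
    moved (inj₂ (_ , j<)) = residue-≢ (≤-trans r₂≤1 1≤a′) a′<n j< ∘ cong proj₂

  hashOK : (r₁ r₂ : ℕ) → r₁ ≤ 1 → r₂ ≤ 1 → HashOK {n} {b} d r₁ r₂ x
  hashOK r₁ r₂ r₁≤1 r₂≤1
    rewrite shifted-min g 0 0 z≤n z≤n (λ i j → cong₂ g (sym (+-identityʳ i)) (sym (+-identityʳ j)))
          | shifted-min (shift g r₁ r₂) r₁ r₂ r₁≤1 r₂≤1 (λ _ _ → refl)
    = ℤ-minus-∸ a r₁ (≤-trans r₁≤1 (proj₁ (proj₁ interior)))
    , ℤ-minus-∸ a′ r₂ (≤-trans r₂≤1 (proj₁ (proj₂ interior)))

-- Failures are witnessed by an edge minimum or a tie

length-concatMap-≤ : (f : A → List B) (c : ℕ) (xs : List A) →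
  (∀ x → length (f x) ≤ c) → length (concatMap f xs) ≤ length xs * c
length-concatMap-≤ f c [] _ = z≤n
length-concatMap-≤ f c (x ∷ xs) |f|≤c =
  ≤-trans (≤-reflexive (length-++ (f x))) (+-mono-≤ (|f|≤c x) (length-concatMap-≤ f c xs |f|≤c))

cells : ℕ → List Cell
cells s = window (s ∸ 1)

∈-cells⁺ : ∀ {s q} → Inside s q → q ∈ cells s
∈-cells⁺ {suc s} (s≤s c≤s , s≤s e≤s) = ∈-window⁺ c≤s e≤s

∈-cells⁻ : ∀ {s q} → 1 ≤ s → q ∈ cells s → Inside s q
∈-cells⁻ {suc s} _ q∈ = s≤s (proj₁ (∈-window⁻ q∈)) , s≤s (proj₂ (∈-window⁻ q∈))

length-cells : ∀ s → 1 ≤ s → length (cells s) ≤ s * s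
length-cells (suc s) _ =
  ≤-trans (length-concatMap-≤ (windowRow s) (suc s) (upTo (suc s))
                              (λ i → ≤-reflexive (trans (length-map (i ,_) (upTo (suc s)))
                                                        (length-upTo (suc s)))))
          (≤-reflexive (cong (_* suc s) (length-upTo (suc s))))

edgeCells : ℕ → ℕ → List Cell
edgeCells s t = (0 , t) ∷ (s ∸ 1 , t) ∷ (t , 0) ∷ (t , s ∸ 1) ∷ []

edges : ℕ → List Cell
edges s = concatMap (edgeCells s) (upTo s)

length-edges : ∀ s → length (edges s) ≤ 4 * s
length-edges s =
  ≤-trans (length-concatMap-≤ (edgeCells s) 4 (upTo s) (λ _ → ≤-refl))
          (≤-reflexive (trans (cong (_* 4) (length-upTo s)) (*-comm s 4)))

inner? : (s a : ℕ) → Dec (Inner s a)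
inner? s a = 0 <? a ×-dec suc a <? s

interior? : (s : ℕ) (t : Cell) → Dec (Interior s t)
interior? s t = inner? s (proj₁ t) ×-dec inner? s (proj₂ t)

outer-coordinate : ∀ {s a} → a < s → ¬ Inner s a → a ≡ 0 ⊎ a ≡ s ∸ 1
outer-coordinate {s} {zero} _ _ = inj₁ refl
outer-coordinate {s} {suc a} 1+a<s ¬inner =
  inj₂ (sym (cong (_∸ 1) (≤-antisym (≮⇒≥ (¬inner ∘ (s≤s z≤n ,_))) 1+a<s)))

∈-edges : ∀ {s t p} → t < s → p ∈ edgeCells s t → p ∈ edges s
∈-edges t<s p∈ = ∈-concat⁺′ p∈ (∈-map⁺ _ (∈-upTo⁺ t<s))

∈-edges⁺ : ∀ {s p} → Inside s p → ¬ Interior s p → p ∈ edges s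
∈-edges⁺ {s} {a , a′} (a<s , a′<s) ¬interior with inner? s a | inner? s a′
... | yes inner | yes inner′ = ⊥-elim (¬interior (inner , inner′))
... | no ¬inner | _ with outer-coordinate a<s ¬inner
...   | inj₁ refl = ∈-edges a′<s (here refl)
...   | inj₂ refl = ∈-edges a′<s (there (here refl))
∈-edges⁺ {s} {a , a′} (a<s , a′<s) _ | yes _ | no ¬inner′ with outer-coordinate a′<s ¬inner′
...   | inj₁ refl = ∈-edges a<s (there (there (here refl)))
...   | inj₂ refl = ∈-edges a<s (there (there (there (here refl))))

n∸1<n : ∀ {n} → 1 ≤ n → n ∸ 1 < n
n∸1<n {suc n} _ = n<1+n n

∈-edges⁻ : ∀ {s p} → 1 ≤ s → p ∈ edges s → Inside s p
∈-edges⁻ {s} 1≤s p∈ with ∈-concat⁻′ (map (edgeCells s) (upTo s)) p∈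
... | _ , p∈group , group∈ with ∈-map⁻ (edgeCells s) group∈
... | t , t∈ , refl with p∈group
... | here refl = 1≤s , ∈-upTo⁻ t∈
... | there (here refl) = n∸1<n 1≤s , ∈-upTo⁻ t∈
... | there (there (here refl)) = ∈-upTo⁻ t∈ , 1≤s
... | there (there (there (here refl))) = ∈-upTo⁻ t∈ , n∸1<n 1≤s

othersThan : ℕ → Cell → List Cell
othersThan s p = filter (λ p′ → ¬? (p′ ≟ᶜ p)) (cells s)

tiesWith : ℕ → Cell → List (List Cell)
tiesWith s p = map (λ p′ → p ∷ p′ ∷ []) (othersThan s p)

ties : ℕ → List (List Cell)
ties s = concatMap (tiesWith s) (cells s)

length-ties : ∀ s → 1 ≤ s → length (ties s) ≤ s * s * (s * s)
length-ties s 1≤s =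
  ≤-trans (length-concatMap-≤ (tiesWith s) (s * s) (cells s) (λ p →
             ≤-trans (≤-reflexive (length-map _ (othersThan s p)))
                     (≤-trans (length-filter (λ p′ → ¬? (p′ ≟ᶜ p)) (cells s)) (length-cells s 1≤s))))
          (*-monoˡ-≤ (s * s) (length-cells s 1≤s))

∈-ties⁺ : ∀ {s p p′} → p ∈ cells s → p′ ∈ cells s → p′ ≢ p → (p ∷ p′ ∷ []) ∈ ties s
∈-ties⁺ {s} {p} p∈ p′∈ p′≢p =
  ∈-concat⁺′ (∈-map⁺ _ (∈-filter⁺ (λ p′ → ¬? (p′ ≟ᶜ p)) p′∈ p′≢p)) (∈-map⁺ (tiesWith s) p∈)

∈-ties⁻ : ∀ {s P} → P ∈ ties s → ∃[ p ] ∃[ p′ ] P ≡ p ∷ p′ ∷ [] × p ∈ cells s × p′ ∈ cells s × p′ ≢ p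
∈-ties⁻ {s} P∈ with ∈-concat⁻′ (map (tiesWith s) (cells s)) P∈
... | _ , P∈pairs , pairs∈ with ∈-map⁻ (tiesWith s) pairs∈
... | p , p∈ , refl with ∈-map⁻ (λ p′ → p ∷ p′ ∷ []) P∈pairs
... | p′ , p′∈filter , refl with ∈-filter⁻ (λ p′ → ¬? (p′ ≟ᶜ p)) p′∈filter
... | p′∈ , p′≢p = p , p′ , refl , p∈ , p′∈ , p′≢p

failurePatterns : ℕ → List (List Cell)
failurePatterns s = map (_∷ []) (edges s) ++ ties s

edge-arithmetic : ∀ s E T → 1 ≤ s → s * s * E ≤ 4 * s * (2 * T) → s * E ≤ 8 * T
edge-arithmetic s@(suc _) E T _ s²E≤8sT =
  *-cancelˡ-≤ s (≤-trans (≤-reflexive (sym (*-assoc s s E))) (≤-trans s²E≤8sT (≤-reflexive (regroup s T))))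
  where
  regroup : ∀ s T → 4 * s * (2 * T) ≡ s * (8 * T)
  regroup = solve-∀

tie-arithmetic : ∀ M s N C T → s * (2 + M) ≤ N → suc M * C * N ≤ (2 + M) * (2 + M) * (2 * T) → s * C ≤ 4 * T
tie-arithmetic M s N C T s[2+M]≤N bound =
  *-cancelˡ-≤ (suc M * (2 + M))
    (begin
      suc M * (2 + M) * (s * C)
    ≡⟨ regroup₁ M s C ⟩
      suc M * C * (s * (2 + M))
    ≤⟨ *-monoʳ-≤ (suc M * C) s[2+M]≤N ⟩
      suc M * C * N
    ≤⟨ bound ⟩
      (2 + M) * (2 + M) * (2 * T)
    ≤⟨ *-monoˡ-≤ (2 * T) (*-monoʳ-≤ (2 + M) (≤-trans (m≤m+n (2 + M) M) (≤-reflexive (double M)))) ⟩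
      (2 + M) * (2 * suc M) * (2 * T)
    ≡⟨ regroup₂ M T ⟩
      suc M * (2 + M) * (4 * T)
    ∎)
  where
  open ≤-Reasoning
  regroup₁ : ∀ M s C → suc M * (2 + M) * (s * C) ≡ suc M * C * (s * (2 + M))
  regroup₁ = solve-∀
  double : ∀ M → 2 + M + M ≡ 2 * suc M
  double = solve-∀
  regroup₂ : ∀ M T → (2 + M) * (2 * suc M) * (2 * T) ≡ suc M * (2 + M) * (4 * T)
  regroup₂ = solve-∀

module Failures (n b : ℕ) .{{_ : NonZero n}} where

  open Counting n b

  covers : ℕ → Grid n b → ℕ
  covers s x = sumBy (λ P → sumBelow N (λ v → matches (pinned s P) v x)) (failurePatterns s)

  module _ (d : ℕ) (x : Grid n b) where

    private
      s : ℕ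
      s = side n d
      w : Cell → ℕ
      w = value {n} {b} x
      p : Cell
      p = argmin w (0 , 0) (cells s)

    1≤side : 1 ≤ s
    1≤side = ⊓-glb (s≤s z≤n) (>-nonZero⁻¹ n)

    p∈cells : p ∈ cells s
    p∈cells = [ (λ p≡origin → subst (_∈ cells s) (sym p≡origin) (∈-cells⁺ (1≤side , 1≤side))) , id ]′
                (argmin-sel w (0 , 0) (cells s))

    p-minimal : ∀ q → Inside s q → w p ≤ w q
    p-minimal q q∈s = All.lookup (f[argmin]≤f[xs] {f = w} (0 , 0) (cells s)) (∈-cells⁺ q∈s)

    witnessed : ∀ {P} → P ∈ failurePatterns s → All (λ p′ → w p′ ≡ w p) P → 1 ≤ covers s x
    witnessed {P} P∈ onP =
      begin
        1
      ≤⟨ gridProd-pos n _ (λ q _ → admits-pinned s (w p) w P onP p-minimal q) ⟩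
        matches (pinned s P) (w p) x
      ≤⟨ sumBelow-∈ N (λ v → matches (pinned s P) v x) (Fin.toℕ<n _) ⟩
        sumBelow N (λ v → matches (pinned s P) v x)
      ≤⟨ sumBy-∈ (λ P → sumBelow N (λ v → matches (pinned s P) v x)) P∈ ⟩
        covers s x
      ∎
      where open ≤-Reasoning

    tie-or-strict : Dec (Any (λ p′ → p′ ≢ p × w p′ ≡ w p) (cells s)) →
      (∃[ p′ ] p′ ∈ cells s × p′ ≢ p × w p′ ≡ w p) ⊎ (∀ q → Inside s q → q ≢ p → w p < w q)
    tie-or-strict (yes tie) = inj₁ (find tie)
    tie-or-strict (no noTie) =
      inj₂ (λ q q∈s q≢p → ≤∧≢⇒< (p-minimal q q∈s) (λ wp≡wq → noTie (lose (∈-cells⁺ q∈s) (q≢p , sym wp≡wq))))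

    failure-covered : (r₁ r₂ : ℕ) → r₁ ≤ 1 → r₂ ≤ 1 → ¬ HashOK {n} {b} d r₁ r₂ x → 1 ≤ covers s x
    failure-covered r₁ r₂ r₁≤1 r₂≤1 failure =
      [ tied , edge-or-interior (interior? s p) ]′
        (tie-or-strict (any? (λ p′ → ¬? (p′ ≟ᶜ p) ×-dec (w p′ ≟ w p)) (cells s)))
      where
      tied : (∃[ p′ ] p′ ∈ cells s × p′ ≢ p × w p′ ≡ w p) → 1 ≤ covers s x
      tied (p′ , p′∈ , p′≢p , wp′≡wp) =
        witnessed (∈-++⁺ʳ (map (_∷ []) (edges s)) (∈-ties⁺ {s} p∈cells p′∈ p′≢p)) (refl ∷ wp′≡wp ∷ [])
      edge-or-interior : Dec (Interior s p) → (∀ q → Inside s q → q ≢ p → w p < w q) → 1 ≤ covers s x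
      edge-or-interior (yes interior) strict = ⊥-elim (failure
        (StrictInteriorMinimum.hashOK {n} {b} x d (proj₁ p) (proj₂ p) interior strict r₁ r₂ r₁≤1 r₂≤1))
      edge-or-interior (no ¬interior) _ =
        witnessed (∈-++⁺ˡ (∈-map⁺ (_∷ []) (∈-edges⁺ {s} (∈-cells⁻ 1≤side p∈cells) ¬interior))) (refl ∷ [])

  failCount-≤ : (d r₁ r₂ : ℕ) → r₁ ≤ 1 → r₂ ≤ 1 →
    failCount n b d r₁ r₂ ≤ sumBy (minCount (side n d)) (failurePatterns (side n d))
  failCount-≤ d r₁ r₂ r₁≤1 r₂≤1 =
    begin
      failCount n b d r₁ r₂
    ≤⟨ length-filter-≤-sumBy _ (covers s) (allGrids n b) (λ x → failure-covered d x r₁ r₂ r₁≤1 r₂≤1) ⟩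
      sumBy (covers s) (allGrids n b)
    ≡⟨ sumBy-comm (λ x P → sumBelow N (λ v → matches (pinned s P) v x)) (allGrids n b) (failurePatterns s) ⟩
      sumBy (λ P → sumBy (λ x → sumBelow N (λ v → matches (pinned s P) v x)) (allGrids n b))
            (failurePatterns s)
    ≡⟨ sumBy-cong (failurePatterns s)
                  (λ P → sumBy-sumBelow-comm N (λ x v → matches (pinned s P) v x) (allGrids n b)) ⟩
      sumBy (minCount s) (failurePatterns s)
    ∎
    where
    open ≤-Reasoning
    s : ℕ
    s = side n d

  failCount-≤-total : (d r₁ r₂ : ℕ) → failCount n b d r₁ r₂ ≤ T
  failCount-≤-total d r₁ r₂ =
    begin
      failCount n b d r₁ r₂
    ≤⟨ length-filter-≤-sumBy _ (matches (λ _ → free) 0) (allGrids n b)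
                             (λ _ _ → gridProd-pos n _ (λ _ _ → ≤-refl)) ⟩
      count (λ _ → free) 0
    ≤⟨ count-≤-capacities (λ _ → free) 0 ⟩
      gridProd n (λ _ → N)
    ≡⟨ gridProd-const n N ⟩
      T
    ∎
    where open ≤-Reasoning

  edges-bound : (s : ℕ) → 1 ≤ s → s ≤ n → s * s ≤ N →
    s * s * sumBy (minCount s) (map (_∷ []) (edges s)) ≤ 4 * s * (2 * T)
  edges-bound s 1≤s s≤n m≤N =
    begin
      s * s * sumBy (minCount s) (map (_∷ []) (edges s))
    ≡⟨ sym (sumBy-*ˡ (s * s) (minCount s) (map (_∷ []) (edges s))) ⟩
      sumBy (λ P → s * s * minCount s P) (map (_∷ []) (edges s))
    ≤⟨ sumBy-≤-length _ (2 * T) _ single ⟩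
      length (map (_∷ []) (edges s)) * (2 * T)
    ≤⟨ *-monoˡ-≤ (2 * T) (≤-trans (≤-reflexive (length-map _ (edges s))) (length-edges s)) ⟩
      4 * s * (2 * T)
    ∎
    where
    open ≤-Reasoning
    1+[m∸1]≡m : 1 + (s * s ∸ 1) ≡ s * s
    1+[m∸1]≡m = m+[n∸m]≡n (*-mono-≤ 1≤s 1≤s)
    single : ∀ {P} → P ∈ map (_∷ []) (edges s) → s * s * minCount s P ≤ 2 * T
    single P∈ with ∈-map⁻ (_∷ []) P∈
    ... | p , p∈ , refl =
      subst (_≤ 2 * T) (trans (*-identityʳ _) (cong (_* minCount s (p ∷ [])) 1+[m∸1]≡m))
        (probability-pinned s 0 (s * s ∸ 1) (p ∷ []) s≤n ([] AllPairs.∷ AllPairs.[]) (∈-edges⁻ 1≤s p∈ ∷ [])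
                            refl 1+[m∸1]≡m (≤-trans (≤-reflexive 1+[m∸1]≡m) m≤N))

  ties-bound : (s M : ℕ) → 1 ≤ s → 2 + M ≡ s * s → s ≤ n → s * s ≤ N →
    suc M * sumBy (minCount s) (ties s) * N ≤ (2 + M) * (2 + M) * (2 * T)
  ties-bound s M 1≤s 2+M≡m s≤n m≤N =
    begin
      suc M * sumBy (minCount s) (ties s) * N
    ≡⟨ cong (_* N) (sym (sumBy-*ˡ (suc M) (minCount s) (ties s))) ⟩
      sumBy (λ P → suc M * minCount s P) (ties s) * N
    ≡⟨ sym (sumBy-*ʳ N _ (ties s)) ⟩
      sumBy (λ P → suc M * minCount s P * N) (ties s)
    ≤⟨ sumBy-≤-length _ (2 * T) (ties s) pair ⟩
      length (ties s) * (2 * T)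
    ≤⟨ *-monoˡ-≤ (2 * T) (≤-trans (length-ties s 1≤s) (≤-reflexive (sym (cong₂ _*_ 2+M≡m 2+M≡m)))) ⟩
      (2 + M) * (2 + M) * (2 * T)
    ∎
    where
    open ≤-Reasoning
    pair : ∀ {P} → P ∈ ties s → suc M * minCount s P * N ≤ 2 * T
    pair P∈ with ∈-ties⁻ {s} P∈
    ... | p , p′ , refl , p∈ , p′∈ , p′≢p =
      subst (_≤ 2 * T) (cong (suc M * minCount s (p ∷ p′ ∷ []) *_) (*-identityʳ N))
        (probability-pinned s 1 M (p ∷ p′ ∷ []) s≤n
                            (((p′≢p ∘ sym) ∷ []) AllPairs.∷ ([] AllPairs.∷ AllPairs.[]))
                            (∈-cells⁻ {s} 1≤s p∈ ∷ ∈-cells⁻ {s} 1≤s p′∈ ∷ [])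
                            refl 2+M≡m (≤-trans (≤-trans (n≤1+n (suc M)) (≤-reflexive 2+M≡m)) m≤N))

  side-failCount : (d r₁ r₂ : ℕ) → r₁ ≤ 1 → r₂ ≤ 1 → n ^ 3 ≤ N →
    side n d * failCount n b d r₁ r₂ ≤ 12 * T
  side-failCount d r₁ r₂ r₁≤1 r₂≤1 n³≤N with 2 ≤? side n d
  ... | no s≱2 =
    ≤-trans (*-monoˡ-≤ (failCount n b d r₁ r₂) (≤-pred (≰⇒> s≱2)))
            (≤-trans (≤-reflexive (+-identityʳ _)) (≤-trans (failCount-≤-total d r₁ r₂) (m≤m+n T _)))
  ... | yes 2≤s =
    begin
      s * failCount n b d r₁ r₂
    ≤⟨ *-monoʳ-≤ s (failCount-≤ d r₁ r₂ r₁≤1 r₂≤1) ⟩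
      s * sumBy (minCount s) (map (_∷ []) (edges s) ++ ties s)
    ≡⟨ cong (s *_) (sumBy-++ (minCount s) (map (_∷ []) (edges s)) (ties s)) ⟩
      s * (sumBy (minCount s) (map (_∷ []) (edges s)) + sumBy (minCount s) (ties s))
    ≡⟨ *-distribˡ-+ s _ _ ⟩
      s * sumBy (minCount s) (map (_∷ []) (edges s)) + s * sumBy (minCount s) (ties s)
    ≤⟨ +-mono-≤ (edge-arithmetic s _ T 1≤s (edges-bound s 1≤s s≤n m≤N))
                (tie-arithmetic M s N _ T (≤-trans (≤-reflexive (cong (s *_) 2+M≡m)) s³≤N)
                                          (ties-bound s M 1≤s 2+M≡m s≤n m≤N)) ⟩
      8 * T + 4 * T
    ≡⟨ sym (*-distribʳ-+ T 8 4) ⟩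
      12 * T
    ∎
    where
    open ≤-Reasoning
    s M : ℕ
    s = side n d
    M = s * s ∸ 2
    1≤s : 1 ≤ s
    1≤s = ≤-trans (s≤s z≤n) 2≤s
    s≤n : s ≤ n
    s≤n = m⊓n≤n _ n
    2+M≡m : 2 + M ≡ s * s
    2+M≡m = m+[n∸m]≡n (≤-trans 2≤s (m≤m*n s s {{>-nonZero 1≤s}}))
    s³≤N : s * (s * s) ≤ N
    s³≤N = ≤-trans (*-mono-≤ s≤n (*-mono-≤ s≤n s≤n))
                   (≤-trans (≤-reflexive (cong (λ k → n * (n * k)) (sym (*-identityʳ n)))) n³≤N)
    m≤N : s * s ≤ N
    m≤N = ≤-trans (m≤n*m (s * s) s {{>-nonZero 1≤s}}) s³≤N

isqrt≤q*side : (p q n d : ℕ) → 1 ≤ p → 1 ≤ q → p * isqrt d ≤ q * n → isqrt d ≤ q * side n d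
isqrt≤q*side p q n d 1≤p 1≤q pk≤qn =
  ≤-trans (⊓-glb k≤q[2+k] k≤qn) (≤-reflexive (sym (*-distribˡ-⊓ q (suc (suc k)) n)))
  where
  k : ℕ
  k = isqrt d
  k≤qn : k ≤ q * n
  k≤qn = ≤-trans (≤-trans (≤-reflexive (sym (*-identityˡ k))) (*-monoˡ-≤ k 1≤p)) pk≤qn
  k≤q[2+k] : k ≤ q * suc (suc k)
  k≤q[2+k] = ≤-trans (≤-trans (n≤1+n k) (n≤1+n (suc k)))
                     (≤-trans (≤-reflexive (sym (*-identityˡ _))) (*-monoˡ-≤ (suc (suc k)) 1≤q))

lemma9 : (p q : ℕ) → 1 ≤ p → 1 ≤ q →
    ∃[ C ] ((n d b : ℕ) .{{_ : NonZero n}} (r₁ r₂ : Fin 2) →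
      1 ≤ d → p * isqrt d ≤ q * n → n ^ 3 ≤ 2 ^ b →
      failCount n b d (toℕ r₁) (toℕ r₂) * isqrt d ≤ C * (2 ^ b) ^ (n * n))
lemma9 p q 1≤p 1≤q = 12 * q , bound
  where
  bound : (n d b : ℕ) .{{_ : NonZero n}} (r₁ r₂ : Fin 2) →
    1 ≤ d → p * isqrt d ≤ q * n → n ^ 3 ≤ 2 ^ b →
    failCount n b d (toℕ r₁) (toℕ r₂) * isqrt d ≤ 12 * q * (2 ^ b) ^ (n * n)
  -- The bound holds for every d.
  bound n d b r₁ r₂ _ pk≤qn n³≤N =
    begin
      F * isqrt d
    ≤⟨ *-monoʳ-≤ F (isqrt≤q*side p q n d 1≤p 1≤q pk≤qn) ⟩
      F * (q * side n d)
    ≡⟨ regroup F q (side n d) ⟩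
      q * (side n d * F)
    ≤⟨ *-monoʳ-≤ q (Failures.side-failCount n b d (toℕ r₁) (toℕ r₂) (unit r₁) (unit r₂) n³≤N) ⟩
      q * (12 * (2 ^ b) ^ (n * n))
    ≡⟨ sym (xy∙z≈y∙xz 12 q _) ⟩
      12 * q * (2 ^ b) ^ (n * n)
    ∎
    where
    open ≤-Reasoning
    F : ℕ
    F = failCount n b d (toℕ r₁) (toℕ r₂)
    unit : (r : Fin 2) → toℕ r ≤ 1
    unit r = ≤-pred (Fin.toℕ<n r)
    regroup : ∀ F q s → F * (q * s) ≡ q * (s * F)
    regroup = solve-∀
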